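{- Let $\alpha$ be a unit-interval parking function of length $n$ that is parking-ordered, with breakpoints $b_1<b_2<\dots<b_k=n$, and set $b_0=0$. Then $\alpha$ decomposes uniquely as a pipe $\alpha=P_1|P_2|\cdots|P_k$ of prime unit-interval parking functions, where $P_j$ has length $b_j-b_{j-1}$ and equals $(1,1,2,\dots,b_j-b_{j-1}-1)$ (read as $(1)$ when $b_j-b_{j-1}=1$). In particular, unit-interval parking functions are characterized as those parking functions whose component primes are all of the form $(1,1,2,\dots,r-1)$, where $r$ is the length of the component prime.
   Context: A parking function of length $n$ is $\alpha=(a_1,\dots,a_n)\in[n]^n$ such that, when cars $1,\dots,n$ arrive in order on a one-way street with spots $1,\dots,n$ and car $i$ parks in the first unoccupied spot $\ge a_i$, every car parks. Car $i$'s displacement is $s_i-a_i$, where $s_i$ is the spot it parks in. A unit-interval parking function is one where every car has displacement at most $1$. $\alpha$ is parking-ordered if $a_i\le i$ for all $i$. The parking rearrangement of $\alpha$ is the tuple $\alpha'$ with $a'_{s_i}=a_i$ for all $i$; it is parking-ordered. $\alpha$ has a breakpoint at $k$ if $|\{i:a_i\le k\}|=k$; it is prime if its only breakpoint is at $n$. For tuples $A$ of length $m$ and $B=(b_1,\dots,b_\ell)$, the pipe $A|B$ is the concatenation of $A$ with $(b_1+m,\dots,b_\ell+m)$, extended inductively to finitely many tuples. For a parking-ordered parking function with breakpoints $b_1<\dots<b_k=n$ ($b_0=0$), its component primes are the tuples $(a_{b_{j-1}+1}-b_{j-1},\dots,a_{b_j}-b_{j-1})$, $j=1,\dots,k$;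 the component primes of an arbitrary parking function are those of its parking rearrangement. -}

module Defs where

open import Data.Nat using (ℕ; zero; suc; _+_; _∸_; _≤_; _≡ᵇ_; _≤?_)
open import Data.Nat.Properties using (_≟_)
open import Data.Bool using (Bool; true; false; if_then_else_)
open import Data.Fin using (Fin; toℕ)
open import Data.List using (List; []; _∷_; _++_; map; length; filter; upTo; take; drop; zip; lookup)
open import Data.Bool.ListAction using (any)
open import Data.Maybe using (Maybe; just; nothing)
open import Data.Product using (_×_; _,_; ∃)
open import Data.List.Relation.Unary.All using (All)
open import Data.List.Relation.Binary.Pointwise using (Pointwise)
open import Relation.Binary.PropositionalEquality using (_≡_)

-- Tuples are lists of naturals; spots and preferences are 1-based.

search : List ℕ → ℕ → ℕ → Maybe ℕ
search occ s zero    = nothing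
search occ s (suc k) = if any (_≡ᵇ s) occ then search occ (suc s) k else just s

parkFrom : ℕ → List ℕ → List ℕ → Maybe (List ℕ)
parkFrom n occ [] = just []
parkFrom n occ (a ∷ as) with search occ a (suc n ∸ a)
... | nothing = nothing
... | just s with parkFrom n (s ∷ occ) as
...   | nothing = nothing
...   | just ss = just (s ∷ ss)

spots : List ℕ → Maybe (List ℕ)
spots α = parkFrom (length α) [] α

IsParkingFunction : List ℕ → Set
IsParkingFunction α =
  All (λ a → 1 ≤ a × a ≤ length α) α × ∃ λ ss → spots α ≡ just ss

IsUnitIntervalPF : List ℕ → Set
IsUnitIntervalPF α =
  All (λ a → 1 ≤ a × a ≤ length α) α ×
  ∃ λ ss → spots α ≡ just ss × Pointwise (λ s a → s ∸ a ≤ 1) ss α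

-- a_i ≤ i for all i (1-based index i = toℕ i + 1).
ParkingOrdered : List ℕ → Set
ParkingOrdered α = (i : Fin (length α)) → lookup α i ≤ suc (toℕ i)

numLE : ℕ → List ℕ → ℕ
numLE k α = length (filter (_≤? k) α)

breakpoints : List ℕ → List ℕ
breakpoints α = filter (λ k → numLE k α ≟ k) (Data.List.map suc (upTo (length α)))

IsPrime : List ℕ → Set
IsPrime α = breakpoints α ≡ length α ∷ []

_∣_ : List ℕ → List ℕ → List ℕ
A ∣ B = A ++ map (_+ length A) B

-- P₁|P₂|...|P_k (pipe is associative).
pipeAll : List (List ℕ) → List ℕ
pipeAll []       = []
pipeAll (P ∷ Ps) = P ∣ pipeAll Ps

-- The tuple (1,1,2,...,r-1) of length r ((1) for r = 1).
std : ℕ → List ℕ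
std zero    = []
std (suc r) = 1 ∷ map suc (upTo r)

diffs : ℕ → List ℕ → List ℕ
diffs prev []       = []
diffs prev (b ∷ bs) = (b ∸ prev) ∷ diffs b bs

blocks : List ℕ → ℕ → List ℕ → List (List ℕ)
blocks β prev []       = []
blocks β prev (b ∷ bs) = map (_∸ prev) (take (b ∸ prev) (drop prev β)) ∷ blocks β b bs

componentPrimesPO : List ℕ → List (List ℕ)
componentPrimesPO β = blocks β 0 (breakpoints β)

-- value a_i of the car with s_i = j
valAt : ℕ → List (ℕ × ℕ) → ℕ
valAt j []             = 0
valAt j ((s , a) ∷ r)  = if s ≡ᵇ j then a else valAt j r

-- Parking rearrangement α' with α'_{s_i} = a_i (only meaningful for
-- parking functions; returns α unchanged if parking fails).
parkingRearrangement : List ℕ → List ℕ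
parkingRearrangement α with spots α
... | nothing = α
... | just ss = map (λ j → valAt j (zip ss α)) (map suc (upTo (length α)))

componentPrimes : List ℕ → List (List ℕ)
componentPrimes α = componentPrimesPO (parkingRearrangement α)

module Submission where

-- If every preference of A is at most |A| and every preference of R is positive,
-- the breakpoints of A ∣ R are those of A followed by those of R shifted by |A|.
-- Hence cutting a parking-ordered tuple at its least breakpoint, again and again,
-- writes it as a pipe of prime parking-ordered tuples, and these are recovered
-- from the pipe as its component primes; in particular such a pipe decomposition
-- is unique. In a parking-ordered tuple car i parks in spot i, so it is
-- unit-interval iff i − 1 ≤ aᵢ ≤ i; scanning left to right, each aᵢ = i starts a
-- new block and each aᵢ = i − 1 extends it, so the blocks are (1,1,2,…,r−1).
-- For an arbitrary parking function the car parked in spot j has preference a'ⱼ,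
-- so α is unit-interval iff its (parking-ordered) rearrangement is.

open import Defs
open import Data.Nat using (ℕ; zero; suc; pred; _+_; _∸_; _≤_; _<_; z≤n; s≤s; _≡ᵇ_; s≤s⁻¹)
open import Data.Nat.Properties
open import Data.List using (List; []; _∷_; _++_; map; length; filter; upTo; take; drop; zip; applyUpTo; [_]; lookup)
open import Data.List.Properties
  using (length-++; length-map; map-++; map-∘; map-cong; map-id; filter-++; filter-none; filter-all;
         map-id-local; take-map; drop-map; take++drop≡id; filter-accept; filter-reject; filter-notAll; length-take;
         map-applyUpTo)
open import Data.List.Relation.Unary.All as All using (All; []; _∷_)
open import Data.List.Relation.Unary.All.Properties using (++⁺; ++⁻ˡ) renaming (map⁺ to All-map⁺)
open import Data.Product using (_×_; _,_; ∃; ∃₂; proj₁; proj₂)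
open import Data.Empty using (⊥-elim)
open import Data.Sum using (_⊎_; inj₁; inj₂; [_,_]′)
open import Function using (_∘_)
open import Function.Bundles using (_⇔_; mk⇔; Equivalence)
open import Function.Properties.Equivalence using () renaming (trans to ⇔-trans)
open import Relation.Nullary using (Dec; yes; no; ¬_; ¬?; contradiction)
open import Data.List.Relation.Unary.Any as Any using (here; there)
open import Data.List.Relation.Unary.Unique.Propositional using (Unique)
open import Data.List.Relation.Unary.AllPairs using ([]; _∷_)
open import Data.List.Membership.Propositional using (_∈_)
open import Data.List.Membership.Propositional.Properties using (∈-filter⁺)
open import Data.List.Membership.DecPropositional _≟_ using (_∈?_)
open import Data.Bool using (true; false; _∨_; if_then_else_)
open import Data.Bool.Properties using (∨-zeroʳ; ∨-conicalˡ; ∨-conicalʳ; T-≡; ¬-not)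
open import Data.Bool.ListAction using (any)
open import Data.Fin as Fin using (Fin; toℕ)
open import Data.Maybe using (just)
open import Data.Maybe.Properties using (just-injective)
open import Data.List.Relation.Binary.Pointwise as Pointwise using (Pointwise; []; _∷_; Pointwise-length)
open import Relation.Binary.PropositionalEquality using (_≡_; _≢_; refl; sym; trans; cong; cong₂; subst; module ≡-Reasoning)

interval : ℕ → ℕ → List ℕ
interval q zero    = []
interval q (suc m) = q ∷ interval (suc q) m

length-interval : ∀ q m → length (interval q m) ≡ m
length-interval q zero    = refl
length-interval q (suc m) = cong suc (length-interval (suc q) m)

applyUpTo-interval : ∀ (f : ℕ → ℕ) q m → (∀ i → f i ≡ q + i) → applyUpTo f m ≡ interval q m
applyUpTo-interval f q zero    f≗ = refl
applyUpTo-interval f q (suc m) f≗ = cong₂ _∷_ (trans (f≗ 0) (+-identityʳ q))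
  (applyUpTo-interval (f ∘ suc) (suc q) m (λ i → trans (f≗ (suc i)) (+-suc q i)))

map-suc-upTo : ∀ n → map suc (upTo n) ≡ interval 1 n
map-suc-upTo n = trans (map-applyUpTo (λ i → i) suc n) (applyUpTo-interval suc 1 n (λ _ → refl))

interval-++ : ∀ q a b → interval q (a + b) ≡ interval q a ++ interval (q + a) b
interval-++ q zero    b = cong (λ r → interval r b) (sym (+-identityʳ q))
interval-++ q (suc a) b = cong (q ∷_) (trans (interval-++ (suc q) a b)
  (cong (λ r → interval (suc q) a ++ interval r b) (sym (+-suc q a))))

interval-∷ʳ : ∀ m → interval 1 (suc m) ≡ interval 1 m ++ [ suc m ]
interval-∷ʳ m = trans (cong (interval 1) (+-comm 1 m)) (interval-++ 1 m 1)

map-+-interval : ∀ q m r → map (_+ r) (interval q m) ≡ interval (q + r) m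
map-+-interval q zero    r = refl
map-+-interval q (suc m) r = cong (q + r ∷_) (map-+-interval (suc q) m r)

All-interval : ∀ {P : ℕ → Set} q m → (∀ i → q ≤ i → i < q + m → P i) → All P (interval q m)
All-interval q zero    h = []
All-interval q (suc m) h = h q ≤-refl (m<m+n q (s≤s z≤n))
  ∷ All-interval (suc q) m (λ i q<i i<q+m → h i (<⇒≤ q<i) (subst (i <_) (sym (+-suc q m)) i<q+m))

module _ {A : Set} where

  filter-≐-local : ∀ {P Q : A → Set} (P? : ∀ x → Dec (P x)) (Q? : ∀ x → Dec (Q x)) xs →
                   All (λ x → (P x → Q x) × (Q x → P x)) xs → filter P? xs ≡ filter Q? xs
  filter-≐-local P? Q? []       []              = refl
  filter-≐-local P? Q? (x ∷ xs) ((P⇒Q , Q⇒P) ∷ h) with P? x | Q? x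
  ... | yes _  | yes _  = cong (x ∷_) (filter-≐-local P? Q? xs h)
  ... | yes px | no ¬qx = ⊥-elim (¬qx (P⇒Q px))
  ... | no ¬px | yes qx = ⊥-elim (¬px (Q⇒P qx))
  ... | no _   | no _   = filter-≐-local P? Q? xs h

  filter-map-local : ∀ {P Q : A → Set} (P? : ∀ x → Dec (P x)) (Q? : ∀ x → Dec (Q x)) (f : A → A) xs →
                     All (λ x → (P (f x) → Q x) × (Q x → P (f x))) xs →
                     filter P? (map f xs) ≡ map f (filter Q? xs)
  filter-map-local P? Q? f []       []              = refl
  filter-map-local P? Q? f (x ∷ xs) ((P⇒Q , Q⇒P) ∷ h) with P? (f x) | Q? x
  ... | yes _  | yes _  = cong (f x ∷_) (filter-map-local P? Q? f xs h)
  ... | yes px | no ¬qx = ⊥-elim (¬qx (P⇒Q px))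
  ... | no ¬px | yes qx = ⊥-elim (¬px (Q⇒P qx))
  ... | no _   | no _   = filter-map-local P? Q? f xs h

numLE-++ : ∀ k xs ys → numLE k (xs ++ ys) ≡ numLE k xs + numLE k ys
numLE-++ k xs ys = trans (cong length (filter-++ (_≤? k) xs ys)) (length-++ (filter (_≤? k) xs))

numLE-map-+ : ∀ k r xs → numLE (k + r) (map (_+ r) xs) ≡ numLE k xs
numLE-map-+ k r xs = trans
  (cong length (filter-map-local (_≤? k + r) (_≤? k) (_+ r) xs
    (All.universal (λ x → +-cancelʳ-≤ r x k , +-monoˡ-≤ r) xs)))
  (length-map (_+ r) (filter (_≤? k) xs))

numLE-∷-≤ : ∀ {k x} xs → x ≤ k → numLE k (x ∷ xs) ≡ suc (numLE k xs)
numLE-∷-≤ xs x≤k = cong length (filter-accept (_≤? _) x≤k)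

numLE-all : ∀ k xs → All (_≤ k) xs → numLE k xs ≡ length xs
numLE-all k xs h = cong length (filter-all (_≤? k) h)

numLE-none : ∀ k xs → All (k <_) xs → numLE k xs ≡ 0
numLE-none k xs h = cong length (filter-none (_≤? k) (All.map <⇒≱ h))

numLE≡0⇒All> : ∀ k xs → numLE k xs ≡ 0 → All (k <_) xs
numLE≡0⇒All> k []       _ = []
numLE≡0⇒All> k (x ∷ xs) e with x ≤? k
... | yes x≤k = ⊥-elim (1+n≢0 (trans (sym (numLE-∷-≤ xs x≤k)) e))
... | no  x≰k = ≰⇒> x≰k ∷ numLE≡0⇒All> k xs (trans (sym (cong length (filter-reject (_≤? k) x≰k))) e)

numLE-interval : ∀ k d → numLE k (interval 1 (k + d)) ≡ k
numLE-interval k d = begin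
  numLE k (interval 1 (k + d))                            ≡⟨ cong (numLE k) (interval-++ 1 k d) ⟩
  numLE k (interval 1 k ++ interval (suc k) d)            ≡⟨ numLE-++ k (interval 1 k) _ ⟩
  numLE k (interval 1 k) + numLE k (interval (suc k) d)   ≡⟨ cong₂ _+_ low high ⟩
  k + 0                                                   ≡⟨ +-identityʳ k ⟩
  k                                                       ∎
  where
  open ≡-Reasoning
  low : numLE k (interval 1 k) ≡ k
  low = trans (numLE-all k _ (All-interval 1 k (λ _ _ i<1+k → s≤s⁻¹ i<1+k))) (length-interval 1 k)
  high : numLE k (interval (suc k) d) ≡ 0
  high = numLE-none k _ (All-interval (suc k) d (λ _ k<i _ → k<i))

data AllFrom (R : ℕ → ℕ → Set) : ℕ → List ℕ → Set where
  []  : ∀ {p} → AllFrom R p []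
  _∷_ : ∀ {p x xs} → R p x → AllFrom R (suc p) xs → AllFrom R p (x ∷ xs)

-- Positions are 0-based. Parking-ordered: the car at position i prefers a spot ≤ i + 1.
-- Such a car parks in spot i + 1, so its displacement is at most 1 iff i ≤ a.
Ordered : ℕ → ℕ → Set
Ordered i a = a ≤ suc i

UnitDisplaced : ℕ → ℕ → Set
UnitDisplaced i a = i ≤ a

ShiftInvariant : (ℕ → ℕ → Set) → Set
ShiftInvariant R = ∀ m {p x} → R (p + m) (x + m) ⇔ R p x

Ordered-shiftInvariant : ShiftInvariant Ordered
Ordered-shiftInvariant m {p} {x} = mk⇔ (+-cancelʳ-≤ m x (suc p)) (+-monoˡ-≤ m)

UnitDisplaced-shiftInvariant : ShiftInvariant UnitDisplaced
UnitDisplaced-shiftInvariant m {p} {x} = mk⇔ (+-cancelʳ-≤ m p x) (+-monoˡ-≤ m)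

module _ {R : ℕ → ℕ → Set} where

  AllFrom-++⁻ : ∀ p A {B} → AllFrom R p (A ++ B) → AllFrom R p A × AllFrom R (p + length A) B
  AllFrom-++⁻ p []      {B} h = [] , subst (λ q → AllFrom R q B) (sym (+-identityʳ p)) h
  AllFrom-++⁻ p (_ ∷ A) {B} (r ∷ h) with AllFrom-++⁻ (suc p) A h
  ... | hA , hB = r ∷ hA , subst (λ q → AllFrom R q B) (sym (+-suc p (length A))) hB

  AllFrom-++⁺ : ∀ p A {B} → AllFrom R p A → AllFrom R (p + length A) B → AllFrom R p (A ++ B)
  AllFrom-++⁺ p []      {B} []       hB = subst (λ q → AllFrom R q B) (+-identityʳ p) hB
  AllFrom-++⁺ p (_ ∷ A) {B} (r ∷ hA) hB =
    r ∷ AllFrom-++⁺ (suc p) A hA (subst (λ q → AllFrom R q B) (+-suc p (length A)) hB)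

  module _ (shift : ShiftInvariant R) where

    AllFrom-map-+⁻ : ∀ m p B → AllFrom R (p + m) (map (_+ m) B) → AllFrom R p B
    AllFrom-map-+⁻ m p []      []      = []
    AllFrom-map-+⁻ m p (_ ∷ B) (r ∷ h) = Equivalence.to (shift m) r ∷ AllFrom-map-+⁻ m (suc p) B h

    AllFrom-map-+⁺ : ∀ m p B → AllFrom R p B → AllFrom R (p + m) (map (_+ m) B)
    AllFrom-map-+⁺ m p []      []      = []
    AllFrom-map-+⁺ m p (_ ∷ B) (r ∷ h) = Equivalence.from (shift m) r ∷ AllFrom-map-+⁺ m (suc p) B h

    AllFrom-pipe⁻ : ∀ Qs → AllFrom R 0 (pipeAll Qs) → All (AllFrom R 0) Qs
    AllFrom-pipe⁻ []       h = []
    AllFrom-pipe⁻ (Q ∷ Qs) h with AllFrom-++⁻ 0 Q h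
    ... | hQ , hQs = hQ ∷ AllFrom-pipe⁻ Qs (AllFrom-map-+⁻ (length Q) 0 (pipeAll Qs) hQs)

    AllFrom-pipe⁺ : ∀ Qs → All (AllFrom R 0) Qs → AllFrom R 0 (pipeAll Qs)
    AllFrom-pipe⁺ []       []         = []
    AllFrom-pipe⁺ (Q ∷ Qs) (hQ ∷ hQs) =
      AllFrom-++⁺ 0 Q hQ (AllFrom-map-+⁺ (length Q) 0 (pipeAll Qs) (AllFrom-pipe⁺ Qs hQs))

Ordered⇒bounded : ∀ p xs → AllFrom Ordered p xs → All (_≤ p + length xs) xs
Ordered⇒bounded p []       []      = []
Ordered⇒bounded p (x ∷ xs) (o ∷ h) =
  ≤-trans o (subst (suc p ≤_) (sym (+-suc p (length xs))) (s≤s (m≤m+n p _)))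
  ∷ subst (λ q → All (_≤ q) xs) (sym (+-suc p (length xs))) (Ordered⇒bounded (suc p) xs h)

Ordered-numLE-length : ∀ β → AllFrom Ordered 0 β → numLE (length β) β ≡ length β
Ordered-numLE-length β h = numLE-all (length β) β (Ordered⇒bounded 0 β h)

pipeAll-positive : ∀ Qs → All (All (1 ≤_)) Qs → All (1 ≤_) (pipeAll Qs)
pipeAll-positive []       []         = []
pipeAll-positive (Q ∷ Qs) (hQ ∷ hQs) =
  ++⁺ hQ (All-map⁺ (All.map (λ {x} 1≤x → ≤-trans 1≤x (m≤m+n x (length Q))) (pipeAll-positive Qs hQs)))

breakpoints-interval : ∀ β → breakpoints β ≡ filter (λ k → numLE k β ≟ k) (interval 1 (length β))
breakpoints-interval β = cong (filter (λ k → numLE k β ≟ k)) (map-suc-upTo (length β))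

length-∣ : ∀ A R → length (A ∣ R) ≡ length A + length R
length-∣ A R = trans (length-++ A) (cong (length A +_) (length-map (_+ length A) R))

numLE-∣-low : ∀ A R k → All (1 ≤_) R → k ≤ length A → numLE k (A ∣ R) ≡ numLE k A
numLE-∣-low A R k hR k≤r = begin
  numLE k (A ∣ R)                                 ≡⟨ numLE-++ k A _ ⟩
  numLE k A + numLE k (map (_+ length A) R)       ≡⟨ cong (numLE k A +_) (numLE-none k _ R+r>k) ⟩
  numLE k A + 0                                   ≡⟨ +-identityʳ _ ⟩
  numLE k A                                       ∎
  where
  open ≡-Reasoning
  R+r>k : All (k <_) (map (_+ length A) R)
  R+r>k = All-map⁺ (All.map (λ 1≤x → +-mono-≤ 1≤x k≤r) hR)

numLE-∣-high : ∀ A R y → All (_≤ length A) A → numLE (y + length A) (A ∣ R) ≡ numLE y R + length A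
numLE-∣-high A R y hA = begin
  numLE (y + r) (A ∣ R)                                  ≡⟨ numLE-++ (y + r) A _ ⟩
  numLE (y + r) A + numLE (y + r) (map (_+ r) R)         ≡⟨ cong₂ _+_ (numLE-all (y + r) A A≤y+r) (numLE-map-+ y r R) ⟩
  r + numLE y R                                          ≡⟨ +-comm r _ ⟩
  numLE y R + r                                          ∎
  where
  open ≡-Reasoning
  r : ℕ
  r = length A
  A≤y+r : All (_≤ y + r) A
  A≤y+r = All.map (λ x≤r → ≤-trans x≤r (m≤n+m r y)) hA

-- Below |A| only A contributes to numLE, and from |A| on all of A does.
breakpoints-∣ : ∀ A R → All (_≤ length A) A → All (1 ≤_) R →
                breakpoints (A ∣ R) ≡ breakpoints A ++ map (_+ length A) (breakpoints R)
breakpoints-∣ A R hA hR = begin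
  breakpoints (A ∣ R)                                         ≡⟨ breakpoints-interval (A ∣ R) ⟩
  filter P? (interval 1 (length (A ∣ R)))                     ≡⟨ cong (filter P? ∘ interval 1) (length-∣ A R) ⟩
  filter P? (interval 1 (r + m))                              ≡⟨ cong (filter P?) (interval-++ 1 r m) ⟩
  filter P? (interval 1 r ++ interval (suc r) m)              ≡⟨ filter-++ P? (interval 1 r) _ ⟩
  filter P? (interval 1 r) ++ filter P? (interval (suc r) m)  ≡⟨ cong₂ _++_ low high ⟩
  breakpoints A ++ map (_+ r) (breakpoints R)                 ∎
  where
  open ≡-Reasoning
  r : ℕ
  r = length A
  m : ℕ
  m = length R
  P? : ∀ k → Dec (numLE k (A ∣ R) ≡ k)
  P? = λ k → numLE k (A ∣ R) ≟ k
  low : filter P? (interval 1 r) ≡ breakpoints A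
  low = trans (filter-≐-local P? (λ k → numLE k A ≟ k) (interval 1 r) (All-interval 1 r same))
              (sym (breakpoints-interval A))
    where
    same : ∀ k → 1 ≤ k → k < 1 + r →
           (numLE k (A ∣ R) ≡ k → numLE k A ≡ k) × (numLE k A ≡ k → numLE k (A ∣ R) ≡ k)
    same k _ k<1+r = trans (sym e) , trans e
      where e = numLE-∣-low A R k hR (s≤s⁻¹ k<1+r)
  high : filter P? (interval (suc r) m) ≡ map (_+ r) (breakpoints R)
  high = begin
    filter P? (interval (suc r) m)                         ≡⟨ cong (filter P?) (sym (map-+-interval 1 m r)) ⟩
    filter P? (map (_+ r) (interval 1 m))
      ≡⟨ filter-map-local P? (λ k → numLE k R ≟ k) (_+ r) (interval 1 m) (All.universal same _) ⟩
    map (_+ r) (filter (λ k → numLE k R ≟ k) (interval 1 m)) ≡⟨ cong (map (_+ r)) (sym (breakpoints-interval R)) ⟩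
    map (_+ r) (breakpoints R)                             ∎
    where
    same : ∀ y → (numLE (y + r) (A ∣ R) ≡ y + r → numLE y R ≡ y) × (numLE y R ≡ y → numLE (y + r) (A ∣ R) ≡ y + r)
    same y = (λ e′ → +-cancelʳ-≡ r _ _ (trans (sym e) e′)) , (λ e′ → trans e (cong (_+ r) e′))
      where e = numLE-∣-high A R y hA

IsPrime-intro : ∀ β i → length β ≡ suc i → (∀ j → j < i → numLE (suc j) β ≢ suc j) →
                numLE (suc i) β ≡ suc i → IsPrime β
IsPrime-intro β i |β|≡1+i notBelow atTop = begin
  breakpoints β                                          ≡⟨ breakpoints-interval β ⟩
  filter P? (interval 1 (length β))                      ≡⟨ cong (filter P? ∘ interval 1) |β|≡1+i ⟩
  filter P? (interval 1 (suc i))                         ≡⟨ cong (filter P?) (interval-∷ʳ i) ⟩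
  filter P? (interval 1 i ++ [ suc i ])                  ≡⟨ filter-++ P? (interval 1 i) _ ⟩
  filter P? (interval 1 i) ++ filter P? [ suc i ]
    ≡⟨ cong₂ _++_ (filter-none P? (All-interval 1 i none)) (filter-accept P? atTop) ⟩
  [ suc i ]                                              ≡⟨ cong [_] (sym |β|≡1+i) ⟩
  [ length β ]                                           ∎
  where
  open ≡-Reasoning
  P? : ∀ k → Dec (numLE k β ≡ k)
  P? = λ k → numLE k β ≟ k
  none : ∀ k → 1 ≤ k → k < 1 + i → numLE k β ≢ k
  none (suc j) _ 1+j<1+i = notBelow j (s≤s⁻¹ 1+j<1+i)

OrderedPrime : List ℕ → Set
OrderedPrime Q = AllFrom Ordered 0 Q × All (1 ≤_) Q × IsPrime Q

breakpoints-pipeAll-∷ : ∀ Q Qs → OrderedPrime Q → All OrderedPrime Qs →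
                        breakpoints (pipeAll (Q ∷ Qs)) ≡ length Q ∷ map (_+ length Q) (breakpoints (pipeAll Qs))
breakpoints-pipeAll-∷ Q Qs (ordQ , _ , primeQ) hQs =
  trans (breakpoints-∣ Q (pipeAll Qs) (Ordered⇒bounded 0 Q ordQ) (pipeAll-positive Qs (All.map (proj₁ ∘ proj₂) hQs)))
        (cong (_++ map (_+ length Q) (breakpoints (pipeAll Qs))) primeQ)

[m+o]∸[n+o]≡m∸n : ∀ m n o → (m + o) ∸ (n + o) ≡ m ∸ n
[m+o]∸[n+o]≡m∸n m n o = trans (cong₂ _∸_ (+-comm m o) (+-comm n o)) ([m+n]∸[m+o]≡n∸o o m n)

diffs-map-+ : ∀ p r bs → diffs (p + r) (map (_+ r) bs) ≡ diffs p bs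
diffs-map-+ p r []       = refl
diffs-map-+ p r (b ∷ bs) = cong₂ _∷_ ([m+o]∸[n+o]≡m∸n b p r) (diffs-map-+ b r bs)

take-length-++ : ∀ (A : List ℕ) X → take (length A) (A ++ X) ≡ A
take-length-++ []      X = refl
take-length-++ (x ∷ A) X = cong (x ∷_) (take-length-++ A X)

drop-+-length-++ : ∀ (A : List ℕ) p X → drop (p + length A) (A ++ X) ≡ drop p X
drop-+-length-++ []      p X = cong (λ q → drop q X) (+-identityʳ p)
drop-+-length-++ (x ∷ A) p X = trans (cong (λ q → drop q (x ∷ A ++ X)) (+-suc p (length A))) (drop-+-length-++ A p X)

blocks-∣ : ∀ A R p bs → blocks (A ∣ R) (p + length A) (map (_+ length A) bs) ≡ blocks R p bs
blocks-∣ A R p []       = refl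
blocks-∣ A R p (b ∷ bs) = cong₂ _∷_ block (blocks-∣ A R b bs)
  where
  open ≡-Reasoning
  r : ℕ
  r = length A
  block : map (_∸ (p + r)) (take ((b + r) ∸ (p + r)) (drop (p + r) (A ∣ R))) ≡ map (_∸ p) (take (b ∸ p) (drop p R))
  block = begin
    map (_∸ (p + r)) (take ((b + r) ∸ (p + r)) (drop (p + r) (A ∣ R)))
      ≡⟨ cong₂ (λ n X → map (_∸ (p + r)) (take n X)) ([m+o]∸[n+o]≡m∸n b p r)
               (trans (drop-+-length-++ A p _) (drop-map p R)) ⟩
    map (_∸ (p + r)) (take (b ∸ p) (map (_+ r) (drop p R)))
      ≡⟨ cong (map (_∸ (p + r))) (take-map (b ∸ p) (drop p R)) ⟩
    map (_∸ (p + r)) (map (_+ r) (take (b ∸ p) (drop p R)))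
      ≡⟨ sym (map-∘ (take (b ∸ p) (drop p R))) ⟩
    map (λ x → (x + r) ∸ (p + r)) (take (b ∸ p) (drop p R))
      ≡⟨ map-cong (λ x → [m+o]∸[n+o]≡m∸n x p r) _ ⟩
    map (_∸ p) (take (b ∸ p) (drop p R))
      ∎

diffs-breakpoints-pipeAll : ∀ Qs → All OrderedPrime Qs → diffs 0 (breakpoints (pipeAll Qs)) ≡ map length Qs
diffs-breakpoints-pipeAll []       []         = refl
diffs-breakpoints-pipeAll (Q ∷ Qs) (hQ ∷ hQs) rewrite breakpoints-pipeAll-∷ Q Qs hQ hQs =
  cong (length Q ∷_) (trans (diffs-map-+ 0 (length Q) _) (diffs-breakpoints-pipeAll Qs hQs))

componentPrimesPO-pipeAll : ∀ Qs → All OrderedPrime Qs → componentPrimesPO (pipeAll Qs) ≡ Qs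
componentPrimesPO-pipeAll []       []         = refl
componentPrimesPO-pipeAll (Q ∷ Qs) (hQ ∷ hQs) rewrite breakpoints-pipeAll-∷ Q Qs hQ hQs =
  cong₂ _∷_ (trans (map-id _) (take-length-++ Q _))
            (trans (blocks-∣ Q (pipeAll Qs) 0 _) (componentPrimesPO-pipeAll Qs hQs))

module _ {P : ℕ → Set} (P? : ∀ i → Dec (P i)) where

  Least : ℕ → Set
  Least k = P k × (∀ i → i < k → ¬ P i)

  least-≤? : ∀ n → (∃ λ k → k ≤ n × Least k) ⊎ (∀ i → i ≤ n → ¬ P i)
  least-≤? zero with P? 0
  ... | yes p0 = inj₁ (0 , z≤n , p0 , λ _ ())
  ... | no ¬p0 = inj₂ λ { zero _ → ¬p0 }
  least-≤? (suc n) with least-≤? n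
  ... | inj₁ (k , k≤n , least) = inj₁ (k , m≤n⇒m≤1+n k≤n , least)
  ... | inj₂ none with P? (suc n)
  ...   | yes p = inj₁ (suc n , ≤-refl , p , λ i i<1+n → none i (s≤s⁻¹ i<1+n))
  ...   | no ¬p = inj₂ λ i i≤1+n → [ none i ∘ s≤s⁻¹ , (λ { refl → ¬p }) ]′ (m≤n⇒m<n∨m≡n i≤1+n)

  least : ∀ n → P n → ∃ λ k → k ≤ n × Least k
  least n p with least-≤? n
  ... | inj₁ found = found
  ... | inj₂ none  = ⊥-elim (none n ≤-refl p)

-- After a breakpoint k of an ordered list every preference exceeds k, so the list
-- is its first k entries piped with the rest shifted down by k.
module BreakpointSplit {β k} (ord : AllFrom Ordered 0 β) (k≤n : k ≤ length β) (bp : numLE k β ≡ k) where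

  A D R : List ℕ
  A = take k β
  D = drop k β
  R = map (_∸ k) D

  length-A : length A ≡ k
  length-A = trans (length-take k β) (m≤n⇒m⊓n≡m k≤n)

  β≡A++D : β ≡ A ++ D
  β≡A++D = sym (take++drop≡id k β)

  ord-A×ord-D : AllFrom Ordered 0 A × AllFrom Ordered (0 + length A) D
  ord-A×ord-D = AllFrom-++⁻ 0 A (subst (AllFrom Ordered 0) β≡A++D ord)

  numLE-A : numLE k A ≡ k
  numLE-A = trans (numLE-all k A (subst (λ n → All (_≤ n) A) length-A (Ordered⇒bounded 0 A (proj₁ ord-A×ord-D))))
                  length-A

  D>k : All (k <_) D
  D>k = numLE≡0⇒All> k D (+-cancelˡ-≡ k _ _ (begin
    k + numLE k D          ≡⟨ cong (_+ numLE k D) numLE-A ⟨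
    numLE k A + numLE k D  ≡⟨ numLE-++ k A D ⟨
    numLE k (A ++ D)       ≡⟨ cong (numLE k) β≡A++D ⟨
    numLE k β              ≡⟨ bp ⟩
    k                      ≡⟨ +-identityʳ k ⟨
    k + 0                  ∎))
    where open ≡-Reasoning

  numLE-A-below : ∀ j → j ≤ k → numLE j A ≡ numLE j β
  numLE-A-below j j≤k = begin
    numLE j A              ≡⟨ +-identityʳ _ ⟨
    numLE j A + 0          ≡⟨ cong (numLE j A +_) (numLE-none j D (All.map (≤-trans (s≤s j≤k)) D>k)) ⟨
    numLE j A + numLE j D  ≡⟨ numLE-++ j A D ⟨
    numLE j (A ++ D)       ≡⟨ cong (numLE j) β≡A++D ⟨
    numLE j β              ∎
    where open ≡-Reasoning

  D≡R+k : D ≡ map (_+ length A) R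
  D≡R+k = begin
    D                          ≡⟨ map-id-local (All.map (λ k<x → m∸n+n≡m (<⇒≤ k<x)) D>k) ⟨
    map (λ x → x ∸ k + k) D    ≡⟨ map-∘ D ⟩
    map (_+ k) R               ≡⟨ cong (λ n → map (_+ n) R) length-A ⟨
    map (_+ length A) R        ∎
    where open ≡-Reasoning

  β≡A∣R : β ≡ A ∣ R
  β≡A∣R = trans β≡A++D (cong (A ++_) D≡R+k)

  R-ordered : AllFrom Ordered 0 R
  R-ordered = AllFrom-map-+⁻ Ordered-shiftInvariant (length A) 0 R (subst (AllFrom Ordered (length A)) D≡R+k (proj₂ ord-A×ord-D))

  R-positive : All (1 ≤_) R
  R-positive = All-map⁺ (All.map m<n⇒0<n∸m D>k)

-- Cutting at the least breakpoint leaves no breakpoint inside the first block.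
first-prime-split : ∀ β → AllFrom Ordered 0 β → All (1 ≤_) β → 0 < length β →
                    ∃₂ λ A R → OrderedPrime A × AllFrom Ordered 0 R × All (1 ≤_) R ×
                               length R < length β × β ≡ A ∣ R
first-prime-split β@(_ ∷ bs) ord pos _
  with least (λ i → numLE (suc i) β ≟ suc i) (length bs) (Ordered-numLE-length β ord)
... | i , i≤|bs| , bp , below =
  A , R , (proj₁ ord-A×ord-D , ++⁻ˡ A (subst (All (1 ≤_)) β≡A++D pos) , A-prime) ,
  R-ordered , R-positive , R-shorter , β≡A∣R
  where
  open BreakpointSplit ord (s≤s i≤|bs|) bp
  A-prime : IsPrime A
  A-prime = IsPrime-intro A i length-A
    (λ j j<i bpA → below j j<i (trans (sym (numLE-A-below (suc j) (s≤s (<⇒≤ j<i)))) bpA))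
    (trans (numLE-A-below (suc i) ≤-refl) bp)
  R-shorter : length R < length β
  R-shorter = subst (length R <_) (sym (trans (cong length β≡A∣R) (trans (length-∣ A R) (cong (_+ length R) length-A))))
                    (m<n+m (length R) (s≤s z≤n))

ordered⇒pipeAll-primes : ∀ β → AllFrom Ordered 0 β → All (1 ≤_) β → ∃ λ Qs → All OrderedPrime Qs × β ≡ pipeAll Qs
ordered⇒pipeAll-primes β = go β (length β) ≤-refl
  where
  go : ∀ β n → length β ≤ n → AllFrom Ordered 0 β → All (1 ≤_) β →
       ∃ λ Qs → All OrderedPrime Qs × β ≡ pipeAll Qs
  go []         _       _       _   _   = [] , [] , refl
  go β@(_ ∷ _) (suc n) |β|≤1+n ord pos with first-prime-split β ord pos (s≤s z≤n)
  ... | A , R , hA , ordR , posR , R<β , β≡A∣R with go R n (s≤s⁻¹ (≤-trans R<β |β|≤1+n)) ordR posR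
  ...   | Qs , hQs , R≡Qs = A ∷ Qs , hA ∷ hQs , trans β≡A∣R (cong (A ∣_) R≡Qs)

std-suc : ∀ j → std (suc j) ≡ 1 ∷ interval 1 j
std-suc j = cong (1 ∷_) (map-suc-upTo j)

length-std : ∀ r → length (std r) ≡ r
length-std zero    = refl
length-std (suc j) = trans (cong length (std-suc j)) (cong suc (length-interval 1 j))

interval-ordered : ∀ q m → AllFrom Ordered q (interval q m)
interval-ordered q zero    = []
interval-ordered q (suc m) = n≤1+n q ∷ interval-ordered (suc q) m

interval-unitDisplaced : ∀ q m → AllFrom UnitDisplaced q (interval q m)
interval-unitDisplaced q zero    = []
interval-unitDisplaced q (suc m) = ≤-refl ∷ interval-unitDisplaced (suc q) m

std-ordered : ∀ r → AllFrom Ordered 0 (std r)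
std-ordered zero    = []
std-ordered (suc j) = subst (AllFrom Ordered 0) (sym (std-suc j)) (≤-refl ∷ interval-ordered 1 j)

std-unitDisplaced : ∀ r → AllFrom UnitDisplaced 0 (std r)
std-unitDisplaced zero    = []
std-unitDisplaced (suc j) = subst (AllFrom UnitDisplaced 0) (sym (std-suc j)) (z≤n ∷ interval-unitDisplaced 1 j)

std-positive : ∀ r → All (1 ≤_) (std r)
std-positive zero    = []
std-positive (suc j) = subst (All (1 ≤_)) (sym (std-suc j)) (≤-refl ∷ All-interval 1 j (λ _ 1≤i _ → 1≤i))

std-prime : ∀ j → IsPrime (std (suc j))
std-prime j = IsPrime-intro (std (suc j)) j (length-std (suc j)) notBelow atTop
  where
  notBelow : ∀ i → i < j → numLE (suc i) (std (suc j)) ≢ suc i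
  notBelow i i<j = 1+n≢n ∘ trans (sym count)
    where
    open ≡-Reasoning
    count : numLE (suc i) (std (suc j)) ≡ suc (suc i)
    count = begin
      numLE (suc i) (std (suc j))                             ≡⟨ cong (numLE (suc i)) (std-suc j) ⟩
      numLE (suc i) (1 ∷ interval 1 j)                        ≡⟨ numLE-∷-≤ (interval 1 j) (s≤s z≤n) ⟩
      suc (numLE (suc i) (interval 1 j))
        ≡⟨ cong (λ n → suc (numLE (suc i) (interval 1 n))) (m+[n∸m]≡n i<j) ⟨
      suc (numLE (suc i) (interval 1 (suc i + (j ∸ suc i))))  ≡⟨ cong suc (numLE-interval (suc i) (j ∸ suc i)) ⟩
      suc (suc i)                                             ∎
  atTop : numLE (suc j) (std (suc j)) ≡ suc j
  atTop = subst (λ n → numLE n (std (suc j)) ≡ n) (length-std (suc j)) (Ordered-numLE-length _ (std-ordered (suc j)))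

std-orderedPrime : ∀ r → 1 ≤ r → OrderedPrime (std r)
std-orderedPrime (suc j) _ = std-ordered (suc j) , std-positive (suc j) , std-prime j

map-length-std : ∀ ls → map length (map std ls) ≡ ls
map-length-std []       = refl
map-length-std (l ∷ ls) = cong₂ _∷_ (length-std l) (map-length-std ls)

map-+-std-∣ : ∀ q m T → map (_+ q) (std (suc m) ∣ T) ≡ suc q ∷ interval (suc q) m ++ map (_+ (suc q + m)) T
map-+-std-∣ q m T = trans (map-++ (_+ q) (std (suc m)) _) (cong₂ _++_ head tail)
  where
  head : map (_+ q) (std (suc m)) ≡ suc q ∷ interval (suc q) m
  head = trans (cong (map (_+ q)) (std-suc m)) (cong (suc q ∷_) (map-+-interval 1 m q))
  shift : ∀ x → x + length (std (suc m)) + q ≡ x + (suc q + m)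
  shift x = trans (+-assoc x _ q) (cong (x +_) (trans (cong (_+ q) (length-std (suc m))) (cong suc (+-comm m q))))
  tail : map (_+ q) (map (_+ length (std (suc m))) T) ≡ map (_+ (suc q + m)) T
  tail = trans (sym (map-∘ T)) (map-cong shift T)

-- The preference at position i is i or i + 1: the value i + 1 opens a new block
-- std r, the value i continues the current one.
unitDisplaced-suffix : ∀ p β → AllFrom UnitDisplaced p β → AllFrom Ordered p β →
                       ∃₂ λ m ls → All (1 ≤_) ls × β ≡ interval p m ++ map (_+ (p + m)) (pipeAll (map std ls))
unitDisplaced-suffix p []       _        _       = 0 , [] , [] , refl
unitDisplaced-suffix p (x ∷ xs) (p≤x ∷ u) (x≤1+p ∷ o) with unitDisplaced-suffix (suc p) xs u o | x ≤? p
... | m , ls , pos , xs≡ | yes x≤p =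
  suc m , ls , pos ,
  cong₂ _∷_ (≤-antisym x≤p p≤x)
            (trans xs≡ (cong (λ n → interval (suc p) m ++ map (_+ n) (pipeAll (map std ls))) (sym (+-suc p m))))
... | m , ls , pos , xs≡ | no x≰p =
  0 , suc m ∷ ls , s≤s z≤n ∷ pos ,
  sym (begin
    map (_+ (p + 0)) (std (suc m) ∣ pipeAll (map std ls))
      ≡⟨ cong (λ n → map (_+ n) (std (suc m) ∣ pipeAll (map std ls))) (+-identityʳ p) ⟩
    map (_+ p) (std (suc m) ∣ pipeAll (map std ls))
      ≡⟨ map-+-std-∣ p m _ ⟩
    suc p ∷ interval (suc p) m ++ map (_+ (suc p + m)) (pipeAll (map std ls))
      ≡⟨ cong₂ _∷_ (≤-antisym x≤1+p (≰⇒> x≰p)) xs≡ ⟨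
    x ∷ xs
      ∎)
  where open ≡-Reasoning

unitDisplaced⇒pipeAll-std : ∀ β → AllFrom UnitDisplaced 0 β → AllFrom Ordered 0 β → All (1 ≤_) β →
                            ∃ λ ls → All (1 ≤_) ls × β ≡ pipeAll (map std ls)
unitDisplaced⇒pipeAll-std β u o pos with unitDisplaced-suffix 0 β u o
... | zero  , ls , pos-ls , β≡ = ls , pos-ls , trans β≡ (map-id-local (All.universal +-identityʳ _))
... | suc m , ls , pos-ls , refl with pos
...   | () ∷ _

All-std-orderedPrime : ∀ ls → All (1 ≤_) ls → All OrderedPrime (map std ls)
All-std-orderedPrime ls pos = All-map⁺ (All.map (λ {l} → std-orderedPrime l) pos)

unitDisplaced⇔components-std : ∀ β → AllFrom Ordered 0 β → All (1 ≤_) β →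
                               AllFrom UnitDisplaced 0 β ⇔ All (λ P → P ≡ std (length P)) (componentPrimesPO β)
unitDisplaced⇔components-std β ord pos = mk⇔ to from
  where
  to : AllFrom UnitDisplaced 0 β → All (λ P → P ≡ std (length P)) (componentPrimesPO β)
  to u with unitDisplaced⇒pipeAll-std β u ord pos
  ... | ls , pos-ls , refl rewrite componentPrimesPO-pipeAll (map std ls) (All-std-orderedPrime ls pos-ls) =
    All-map⁺ (All.universal (λ l → cong std (sym (length-std l))) ls)
  from : All (λ P → P ≡ std (length P)) (componentPrimesPO β) → AllFrom UnitDisplaced 0 β
  from h with ordered⇒pipeAll-primes β ord pos
  ... | Qs , hQs , refl rewrite componentPrimesPO-pipeAll Qs hQs =
    AllFrom-pipe⁺ UnitDisplaced-shiftInvariant Qs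
      (All.map (λ {Q} Q≡ → subst (AllFrom UnitDisplaced 0) (sym Q≡) (std-unitDisplaced (length Q))) h)

parkingOrdered⇒Ordered : ∀ α → ParkingOrdered α → AllFrom Ordered 0 α
parkingOrdered⇒Ordered α po = go 0 α (λ i → subst (lookup α i ≤_) (cong suc (sym (+-identityˡ (toℕ i)))) (po i))
  where
  go : ∀ p xs → ((i : Fin (length xs)) → lookup xs i ≤ suc (p + toℕ i)) → AllFrom Ordered p xs
  go p []       _  = []
  go p (x ∷ xs) po = subst (λ q → x ≤ suc q) (+-identityʳ p) (po Fin.zero)
                   ∷ go (suc p) xs (λ i → subst (λ q → lookup xs i ≤ suc q) (+-suc p (toℕ i)) (po (Fin.suc i)))

≡ᵇ-refl : ∀ n → (n ≡ᵇ n) ≡ true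
≡ᵇ-refl n = Equivalence.to T-≡ (≡⇒≡ᵇ n n refl)

≢⇒≡ᵇ≡false : ∀ m n → m ≢ n → (m ≡ᵇ n) ≡ false
≢⇒≡ᵇ≡false m n m≢n = ¬-not (m≢n ∘ ≡ᵇ⇒≡ m n ∘ Equivalence.from T-≡)

occupied : ℕ → List ℕ
occupied zero    = []
occupied (suc p) = suc p ∷ occupied p

any-occupied-≤ : ∀ p s → 1 ≤ s → s ≤ p → any (_≡ᵇ s) (occupied p) ≡ true
any-occupied-≤ zero    (suc _) _ ()
any-occupied-≤ (suc p) s 1≤s s≤1+p with m≤n⇒m<n∨m≡n s≤1+p
... | inj₁ s<1+p = trans (cong ((suc p ≡ᵇ s) ∨_) (any-occupied-≤ p s 1≤s (s≤s⁻¹ s<1+p))) (∨-zeroʳ _)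
... | inj₂ refl  = cong (_∨ any (_≡ᵇ suc p) (occupied p)) (≡ᵇ-refl (suc p))

any-occupied-> : ∀ p s → p < s → any (_≡ᵇ s) (occupied p) ≡ false
any-occupied-> zero    s p<s = refl
any-occupied-> (suc p) s p<s =
  cong₂ _∨_ (≢⇒≡ᵇ≡false (suc p) s (λ e → <-irrefl e p<s)) (any-occupied-> p s (<-trans (n<1+n p) p<s))

search-occupied : ∀ p s f → 1 ≤ s → s ≤ suc p → suc p ∸ s ≤ f → search (occupied p) s (suc f) ≡ just (suc p)
search-occupied p s f 1≤s s≤1+p gap with m≤n⇒m<n∨m≡n s≤1+p
... | inj₂ refl rewrite any-occupied-> p (suc p) (n<1+n p) = refl
search-occupied p s zero    1≤s _ gap | inj₁ s<1+p = ⊥-elim (<⇒≱ (m<n⇒0<n∸m s<1+p) gap)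
search-occupied p s (suc f) 1≤s _ gap | inj₁ s<1+p rewrite any-occupied-≤ p s 1≤s (s≤s⁻¹ s<1+p) =
  search-occupied p (suc s) f (≤-trans 1≤s (n≤1+n s)) s<1+p
    (s≤s⁻¹ (subst (_≤ suc f) (+-∸-assoc 1 (s≤s⁻¹ s<1+p)) gap))

parkFrom-ordered : ∀ n p xs → AllFrom Ordered p xs → All (1 ≤_) xs → p + length xs ≤ n →
                   parkFrom n (occupied p) xs ≡ just (interval (suc p) (length xs))
parkFrom-ordered n p []       _        _          _  = refl
parkFrom-ordered n p (x ∷ xs) (x≤1+p ∷ o) (1≤x ∷ pos) le = park (subst (_≤ n) (+-suc p (length xs)) le)
  where
  park : suc p + length xs ≤ n → parkFrom n (occupied p) (x ∷ xs) ≡ just (interval (suc p) (suc (length xs)))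
  park le′
    rewrite +-∸-assoc 1 (≤-trans x≤1+p (m+n≤o⇒m≤o (suc p) le′))
          | search-occupied p x (n ∸ x) 1≤x x≤1+p (∸-monoˡ-≤ x (m+n≤o⇒m≤o (suc p) le′))
          | parkFrom-ordered n (suc p) xs o pos le′ = refl

spots-ordered : ∀ α → AllFrom Ordered 0 α → All (1 ≤_) α → spots α ≡ just (interval 1 (length α))
spots-ordered α o pos = parkFrom-ordered (length α) 0 α o pos ≤-refl

UnitDisplacement : ℕ → ℕ → Set
UnitDisplacement s a = s ∸ a ≤ 1

UnitDisplacement⇔UnitDisplaced : ∀ p a → UnitDisplacement (suc p) a ⇔ UnitDisplaced p a
UnitDisplacement⇔UnitDisplaced p a = mk⇔
  (λ d → s≤s⁻¹ (≤-trans (m≤n+m∸n (suc p) a) (subst (a + (suc p ∸ a) ≤_) (+-comm a 1) (+-monoʳ-≤ a d))))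
  (λ p≤a → m≤n+o⇒m∸n≤o (suc p) a (subst (suc p ≤_) (+-comm 1 a) (s≤s p≤a)))

unitDisplaced⇔unitDisplacement : ∀ p xs →
  AllFrom UnitDisplaced p xs ⇔ Pointwise UnitDisplacement (interval (suc p) (length xs)) xs
unitDisplaced⇔unitDisplacement p xs = mk⇔ (to p xs) (from p xs)
  where
  to : ∀ p xs → AllFrom UnitDisplaced p xs → Pointwise UnitDisplacement (interval (suc p) (length xs)) xs
  to p []       []        = []
  to p (x ∷ xs) (p≤x ∷ u) = Equivalence.from (UnitDisplacement⇔UnitDisplaced p x) p≤x ∷ to (suc p) xs u
  from : ∀ p xs → Pointwise UnitDisplacement (interval (suc p) (length xs)) xs → AllFrom UnitDisplaced p xs
  from p []       []       = []
  from p (x ∷ xs) (d ∷ ds) = Equivalence.to (UnitDisplacement⇔UnitDisplaced p x) d ∷ from (suc p) xs ds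

unitIntervalPF⇔unitDisplaced : ∀ α → AllFrom Ordered 0 α → All (1 ≤_) α →
                               IsUnitIntervalPF α ⇔ AllFrom UnitDisplaced 0 α
unitIntervalPF⇔unitDisplaced α o pos = mk⇔ to from
  where
  spots≡ : spots α ≡ just (interval 1 (length α))
  spots≡ = spots-ordered α o pos
  to : IsUnitIntervalPF α → AllFrom UnitDisplaced 0 α
  to (_ , ss , spots≡ss , d) =
    Equivalence.from (unitDisplaced⇔unitDisplacement 0 α)
      (subst (λ ss → Pointwise UnitDisplacement ss α) (just-injective (trans (sym spots≡ss) spots≡)) d)
  from : AllFrom UnitDisplaced 0 α → IsUnitIntervalPF α
  from u = All.zip (pos , Ordered⇒bounded 0 α o) , interval 1 (length α) , spots≡ ,
           Equivalence.to (unitDisplaced⇔unitDisplacement 0 α) u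

Free : List ℕ → ℕ → Set
Free occ s = any (_≡ᵇ s) occ ≡ false

Free-∷⁻ : ∀ s occ {t} → Free (s ∷ occ) t → s ≢ t × Free occ t
Free-∷⁻ s occ free =
  (λ { refl → contradiction (trans (sym (≡ᵇ-refl s)) (∨-conicalˡ _ _ free)) λ () }) , ∨-conicalʳ _ _ free

search-sound : ∀ occ a f {s} → search occ a f ≡ just s → a ≤ s × s < a + f × Free occ s
search-sound occ a (suc f) {s} found with any (_≡ᵇ a) occ in a-taken
... | true with search-sound occ (suc a) f found
...   | a<s , s<1+a+f , free = <⇒≤ a<s , subst (s <_) (sym (+-suc a f)) s<1+a+f , free
search-sound occ a (suc f) refl | false = ≤-refl , m<m+n a (s≤s z≤n) , a-taken

ParksWithin : ℕ → ℕ → ℕ → Set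
ParksWithin n s a = 1 ≤ a × a ≤ s × s ≤ n

parkFrom-sound : ∀ n occ xs {ss} → All (λ a → 1 ≤ a × a ≤ n) xs → parkFrom n occ xs ≡ just ss →
                 Pointwise (ParksWithin n) ss xs × All (Free occ) ss × Unique ss
parkFrom-sound n occ []       _ refl = [] , [] , []
parkFrom-sound n occ (x ∷ xs) (bx ∷ bxs) parked with search occ x (suc n ∸ x) in found
... | just s with parkFrom n (s ∷ occ) xs in rest
parkFrom-sound n occ (x ∷ xs) ((1≤x , x≤n) ∷ bxs) refl | just s | just ss
  with search-sound occ x (suc n ∸ x) found | parkFrom-sound n (s ∷ occ) xs bxs rest
... | x≤s , s<x+[1+n∸x] , free | parks , frees , unique =
  (1≤x , x≤s , s≤n) ∷ parks ,
  free ∷ All.map (proj₂ ∘ Free-∷⁻ s occ) frees ,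
  All.map (proj₁ ∘ Free-∷⁻ s occ) frees ∷ unique
  where
  s≤n : s ≤ n
  s≤n = s≤s⁻¹ (subst (s <_) (m+[n∸m]≡n (≤-trans x≤n (n≤1+n n))) s<x+[1+n∸x])

Pointwise⇒Allˡ : ∀ {R : ℕ → ℕ → Set} {P : ℕ → Set} {xs ys} →
                 (∀ {x y} → R x y → P x) → Pointwise R xs ys → All P xs
Pointwise⇒Allˡ f []       = []
Pointwise⇒Allˡ f (r ∷ rs) = f r ∷ Pointwise⇒Allˡ f rs

Unique⇒length≤ : ∀ {xs ys : List ℕ} → Unique xs → All (_∈ ys) xs → length xs ≤ length ys
Unique⇒length≤ {[]}     _              _               = z≤n
Unique⇒length≤ {x ∷ xs} {ys} (x∉xs ∷ u) (x∈ys ∷ xs⊆ys) =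
  ≤-trans (s≤s (Unique⇒length≤ u
            (All.zipWith (λ (y∈ys , x≢y) → ∈-filter⁺ P? y∈ys (x≢y ∘ sym)) (xs⊆ys , x∉xs))))
          (filter-notAll P? ys (Any.map (λ x≡y y≢x → y≢x (sym x≡y)) x∈ys))
  where
  P? : ∀ t → Dec (¬ t ≡ x)
  P? = λ t → ¬? (t ≟ x)

∈-interval : ∀ q m {j} → q ≤ j → j < q + m → j ∈ interval q m
∈-interval q zero    q≤j j<q+0 = ⊥-elim (<⇒≱ j<q+0 (subst (_≤ _) (sym (+-identityʳ q)) q≤j))
∈-interval q (suc m) {j} q≤j j<q+1+m with m≤n⇒m<n∨m≡n q≤j
... | inj₂ refl = here refl
... | inj₁ q<j  = there (∈-interval (suc q) m q<j (subst (j <_) (+-suc q m) j<q+1+m))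

Unique-interval-complete : ∀ n ss → length ss ≡ n → Unique ss → All (λ s → 1 ≤ s × s ≤ n) ss →
                           ∀ j → 1 ≤ j → j ≤ n → j ∈ ss
Unique-interval-complete n ss |ss|≡n u bounds j 1≤j j≤n with j ∈? ss
... | yes j∈ss = j∈ss
... | no  j∉ss = ⊥-elim (<⇒≱ others<n (subst (_≤ length others) |ss|≡n ss≤others))
  where
  P? : ∀ t → Dec (¬ t ≡ j)
  P? = λ t → ¬? (t ≟ j)
  others : List ℕ
  others = filter P? (interval 1 n)
  ss≤others : length ss ≤ length others
  ss≤others = Unique⇒length≤ u (All.tabulate λ {s} s∈ss →
    let (1≤s , s≤n) = All.lookup bounds s∈ss in
    ∈-filter⁺ P? (∈-interval 1 n 1≤s (s≤s s≤n)) (λ { refl → j∉ss s∈ss }))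
  others<n : length others < n
  others<n = subst (length others <_) (length-interval 1 n)
    (filter-notAll P? (interval 1 n) (Any.map (λ j≡t t≢j → t≢j (sym j≡t)) (∈-interval 1 n 1≤j (s≤s j≤n))))

valAt-∈ : ∀ {R : ℕ → ℕ → Set} {ss xs j} → Pointwise R ss xs → j ∈ ss → R j (valAt j (zip ss xs))
valAt-∈ {R} {s ∷ _} {a ∷ _} {j} (r ∷ rs) j∈ with s ≡ᵇ j in s≡ᵇj
... | true = subst (λ t → R t a) (≡ᵇ⇒≡ s j (Equivalence.from T-≡ s≡ᵇj)) r
valAt-∈ {ss = s ∷ _} (r ∷ rs) (here refl)  | false = contradiction (trans (sym (≡ᵇ-refl s)) s≡ᵇj) λ ()
valAt-∈ (r ∷ rs) (there j∈ss) | false = valAt-∈ rs j∈ss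

valAt-self : ∀ {R : ℕ → ℕ → Set} {ss xs} → Unique ss → Pointwise R ss xs →
             Pointwise (λ s a → R s a × valAt s (zip ss xs) ≡ a) ss xs
valAt-self []           []       = []
valAt-self {R} {s ∷ ss} {a ∷ xs} (s∉ss ∷ u) (r ∷ rs) = (r , head) ∷ skip s∉ss (valAt-self u rs)
  where
  head : valAt s (zip (s ∷ ss) (a ∷ xs)) ≡ a
  head rewrite ≡ᵇ-refl s = refl
  skip : ∀ {ts bs} → All (s ≢_) ts → Pointwise (λ t b → R t b × valAt t (zip ss xs) ≡ b) ts bs →
         Pointwise (λ t b → R t b × valAt t (zip (s ∷ ss) (a ∷ xs)) ≡ b) ts bs
  skip []               []             = []
  skip {t ∷ _} (s≢t ∷ s∉ts) ((r , e) ∷ rs) =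
    (r , trans (cong (if_then a else valAt t (zip ss xs)) (≢⇒≡ᵇ≡false s t s≢t)) e) ∷ skip s∉ts rs

AllFrom-map-interval⇔ : ∀ {R : ℕ → ℕ → Set} (V : ℕ → ℕ) p k →
                        AllFrom R p (map V (interval (suc p) k)) ⇔ (∀ j → p < j → j ≤ p + k → R (pred j) (V j))
AllFrom-map-interval⇔ {R} V p k = mk⇔ (to p k) (from p k)
  where
  to : ∀ p k → AllFrom R p (map V (interval (suc p) k)) → ∀ j → p < j → j ≤ p + k → R (pred j) (V j)
  to p zero    []      j p<j j≤p+0 = ⊥-elim (<⇒≱ p<j (subst (j ≤_) (+-identityʳ p) j≤p+0))
  to p (suc k) (r ∷ h) j p<j j≤p+1+k with m≤n⇒m<n∨m≡n p<j
  ... | inj₂ refl = r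
  ... | inj₁ 1+p<j = to (suc p) k h j 1+p<j (subst (j ≤_) (+-suc p k) j≤p+1+k)
  from : ∀ p k → (∀ j → p < j → j ≤ p + k → R (pred j) (V j)) → AllFrom R p (map V (interval (suc p) k))
  from p zero    h = []
  from p (suc k) h = h (suc p) ≤-refl (subst (suc p ≤_) (sym (+-suc p k)) (s≤s (m≤m+n p k)))
                   ∷ from (suc p) k (λ j 1+p<j j≤1+p+k →
                       h j (<-trans (n<1+n p) 1+p<j) (subst (j ≤_) (sym (+-suc p k)) j≤1+p+k))

parkingRearrangement-spots : ∀ α {ss} → spots α ≡ just ss →
                             parkingRearrangement α ≡ map (λ j → valAt j (zip ss α)) (interval 1 (length α))
parkingRearrangement-spots α spots≡ with spots α
parkingRearrangement-spots α refl | just ss = cong (map (λ j → valAt j (zip ss α))) (map-suc-upTo (length α))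

-- Every spot is taken, and the car in spot j preferred a spot in 1..j, so the
-- rearrangement is parking-ordered and that car's displacement is j − a'ⱼ.
module Rearrangement {α ss} (bounds : All (λ a → 1 ≤ a × a ≤ length α) α) (spots≡ : spots α ≡ just ss) where

  private
    n : ℕ
    n = length α
    V : ℕ → ℕ
    V j = valAt j (zip ss α)
    sound : Pointwise (ParksWithin n) ss α × All (Free []) ss × Unique ss
    sound = parkFrom-sound n [] α bounds spots≡
    parks : Pointwise (ParksWithin n) ss α
    parks = proj₁ sound
    unique : Unique ss
    unique = proj₂ (proj₂ sound)

    complete : ∀ j → 1 ≤ j → j ≤ n → j ∈ ss
    complete = Unique-interval-complete n ss (Pointwise-length parks) unique
                 (Pointwise⇒Allˡ (λ (1≤a , a≤s , s≤n) → ≤-trans 1≤a a≤s , s≤n) parks)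

    rearrangement≡ : parkingRearrangement α ≡ map V (interval 1 n)
    rearrangement≡ = parkingRearrangement-spots α spots≡

    R-parks : ∀ j → 1 ≤ j → j ≤ n → ParksWithin n j (V j)
    R-parks j 1≤j j≤n = valAt-∈ parks (complete j 1≤j j≤n)

  rearrangement-ordered : AllFrom Ordered 0 (parkingRearrangement α)
  rearrangement-ordered = subst (AllFrom Ordered 0) (sym rearrangement≡)
    (Equivalence.from (AllFrom-map-interval⇔ V 0 n) λ { (suc j) 0<j j≤n → proj₁ (proj₂ (R-parks (suc j) 0<j j≤n)) })

  rearrangement-positive : All (1 ≤_) (parkingRearrangement α)
  rearrangement-positive = subst (All (1 ≤_)) (sym rearrangement≡)
    (All-map⁺ (All-interval 1 n λ j 1≤j j<1+n → proj₁ (R-parks j 1≤j (s≤s⁻¹ j<1+n))))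

  unitIntervalPF⇔rearrangement-unitDisplaced : IsUnitIntervalPF α ⇔ AllFrom UnitDisplaced 0 (parkingRearrangement α)
  unitIntervalPF⇔rearrangement-unitDisplaced =
    subst (λ β → IsUnitIntervalPF α ⇔ AllFrom UnitDisplaced 0 β) (sym rearrangement≡) (mk⇔ to from)
    where
    to : IsUnitIntervalPF α → AllFrom UnitDisplaced 0 (map V (interval 1 n))
    to (_ , ss′ , spots≡ss′ , d) = Equivalence.from (AllFrom-map-interval⇔ V 0 n)
      λ { (suc j) 0<j j≤n → Equivalence.to (UnitDisplacement⇔UnitDisplaced j _) (valAt-∈ d′ (complete (suc j) 0<j j≤n)) }
      where
      d′ : Pointwise UnitDisplacement ss α
      d′ = subst (λ ss → Pointwise UnitDisplacement ss α) (just-injective (trans (sym spots≡ss′) spots≡)) d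
    from : AllFrom UnitDisplaced 0 (map V (interval 1 n)) → IsUnitIntervalPF α
    from u = bounds , ss , spots≡ , Pointwise.map displacement (valAt-self unique parks)
      where
      displacement : ∀ {s a} → ParksWithin n s a × V s ≡ a → UnitDisplacement s a
      displacement {zero}  ((1≤a , a≤0 , _) , _) = ⊥-elim (<⇒≱ (≤-trans 1≤a a≤0) ≤-refl)
      displacement {suc s} ((_ , _ , s<n) , refl) =
        Equivalence.from (UnitDisplacement⇔UnitDisplaced s _)
          (Equivalence.to (AllFrom-map-interval⇔ V 0 n) u (suc s) (s≤s z≤n) s<n)

pipeAll-injective : ∀ Qs Qs′ → All OrderedPrime Qs → All OrderedPrime Qs′ → pipeAll Qs ≡ pipeAll Qs′ → Qs ≡ Qs′
pipeAll-injective Qs Qs′ hQs hQs′ eq = begin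
  Qs                           ≡⟨ componentPrimesPO-pipeAll Qs hQs ⟨
  componentPrimesPO (pipeAll Qs)   ≡⟨ cong componentPrimesPO eq ⟩
  componentPrimesPO (pipeAll Qs′)  ≡⟨ componentPrimesPO-pipeAll Qs′ hQs′ ⟩
  Qs′                          ∎
  where open ≡-Reasoning

pipeAll-primes-ordered : ∀ Qs → AllFrom Ordered 0 (pipeAll Qs) → All (λ Q → IsUnitIntervalPF Q × IsPrime Q) Qs →
                         All OrderedPrime Qs
pipeAll-primes-ordered Qs ord h =
  All.zipWith (λ (o , (bounds , _) , prime) → o , All.map proj₁ bounds , prime) (AllFrom-pipe⁻ Ordered-shiftInvariant Qs ord , h)

unitIntervalPF-std : ∀ r → IsUnitIntervalPF (std r)
unitIntervalPF-std r = Equivalence.from (unitIntervalPF⇔unitDisplaced (std r) (std-ordered r) (std-positive r)) (std-unitDisplaced r)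

unitIntervalPF-blocks : ∀ α → IsUnitIntervalPF α → AllFrom Ordered 0 α →
                        ∃ λ ls → All (1 ≤_) ls × diffs 0 (breakpoints α) ≡ ls × α ≡ pipeAll (map std ls)
unitIntervalPF-blocks α uipf@(bounds , _) ord
  with unitDisplaced⇒pipeAll-std α (Equivalence.to (unitIntervalPF⇔unitDisplaced α ord (All.map proj₁ bounds)) uipf)
                                 ord (All.map proj₁ bounds)
... | ls , pos-ls , α≡ = ls , pos-ls , lengths , α≡
  where
  lengths : diffs 0 (breakpoints α) ≡ ls
  lengths = trans (cong (diffs 0 ∘ breakpoints) α≡)
                  (trans (diffs-breakpoints-pipeAll _ (All-std-orderedPrime ls pos-ls)) (map-length-std ls))

unitIntervalPF-pipe-decomposition : (α : List ℕ) → IsUnitIntervalPF α → ParkingOrdered α →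
  All (λ P → IsUnitIntervalPF P × IsPrime P) (map std (diffs 0 (breakpoints α)))
  × pipeAll (map std (diffs 0 (breakpoints α))) ≡ α
  × ((Qs : List (List ℕ)) → All (λ Q → IsUnitIntervalPF Q × IsPrime Q) Qs →
      pipeAll Qs ≡ α → Qs ≡ map std (diffs 0 (breakpoints α)))
unitIntervalPF-pipe-decomposition α uipf po with unitIntervalPF-blocks α uipf (parkingOrdered⇒Ordered α po)
... | ls , pos-ls , diffs≡ls , α≡ rewrite diffs≡ls =
  All-map⁺ (All.map (λ {l} 1≤l → unitIntervalPF-std l , proj₂ (proj₂ (std-orderedPrime l 1≤l))) pos-ls) ,
  sym α≡ ,
  λ Qs hQs pipe≡ → pipeAll-injective Qs (map std ls)
    (pipeAll-primes-ordered Qs (subst (AllFrom Ordered 0) (sym pipe≡) (parkingOrdered⇒Ordered α po)) hQs)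
    (All-std-orderedPrime ls pos-ls) (trans pipe≡ α≡)

unitIntervalPF⇔componentPrimes-std : (α : List ℕ) → IsParkingFunction α →
  IsUnitIntervalPF α ⇔ All (λ P → P ≡ std (length P)) (componentPrimes α)
unitIntervalPF⇔componentPrimes-std α (bounds , ss , spots≡) =
  ⇔-trans unitIntervalPF⇔rearrangement-unitDisplaced
          (unitDisplaced⇔components-std _ rearrangement-ordered rearrangement-positive)
  where open Rearrangement bounds spots≡

theorem2p8 : ((α : List ℕ) → IsUnitIntervalPF α → ParkingOrdered α →
      All (λ P → IsUnitIntervalPF P × IsPrime P) (map std (diffs 0 (breakpoints α)))
      × pipeAll (map std (diffs 0 (breakpoints α))) ≡ α
      × ((Qs : List (List ℕ)) → All (λ Q → IsUnitIntervalPF Q × IsPrime Q) Qs →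
          pipeAll Qs ≡ α → Qs ≡ map std (diffs 0 (breakpoints α))))
    × ((α : List ℕ) → IsParkingFunction α →
        IsUnitIntervalPF α ⇔ All (λ P → P ≡ std (length P)) (componentPrimes α))
theorem2p8 = unitIntervalPF-pipe-decomposition , unitIntervalPF⇔componentPrimes-std
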